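{- For every intuitionistic modal logic $\mathbf{L}$ contained in $\mathbf{L}_{\mathbf{fbdc}}$, $\square$ and $\lozenge$ are independent in $\mathbf{L}$; that is, there is no $\square$-free formula $A$ such that $\square p\leftrightarrow A\in\mathbf{L}$, and there is no $\lozenge$-free formula $A$ such that $\lozenge p\leftrightarrow A\in\mathbf{L}$.
   Context: Formulas are built from a countably infinite set of atoms by $A::=p\mid (A\rightarrow A)\mid\top\mid\bot\mid(A\vee A)\mid(A\wedge A)\mid\square A\mid\lozenge A$; $\neg A$ abbreviates $A\rightarrow\bot$ and $A\leftrightarrow B$ abbreviates $(A\rightarrow B)\wedge(B\rightarrow A)$. An intuitionistic modal logic is a set of formulas closed under uniform substitution, containing the axioms of intuitionistic propositional logic, closed under modus ponens, containing (A1) $\square(p\rightarrow q)\rightarrow(\square p\rightarrow\square q)$, (A2) $\square(p\vee q)\rightarrow((\lozenge p\rightarrow\square q)\rightarrow\square q)$, (A3) $\lozenge(p\vee q)\rightarrow\lozenge p\vee\lozenge q$, (A4) $\neg\lozenge\bot$, and closed under (R1) from $p$ infer $\square p$, (R2) from $p\rightarrow q$ infer $\lozenge p\rightarrow\lozenge q$, (R3) from $\lozenge p\rightarrow q\vee\square(p\rightarrow r)$ infer $\lozenge p\rightarrow q\vee\lozenge r$. $\mathbf{L}_{\min}$ is the least one; $\mathbf{L}\oplus\Sigma$ the least one containing $\mathbf{L}$ and $\Sigma$. $\mathbf{L}_{\mathbf{fbdc}}=\mathbf{L}_{\min}\oplus\{\lozenge(p\rightarrow q)\rightarrow(\square p\rightarrow\lozenge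 q),\ (\lozenge p\rightarrow\square q)\rightarrow\square(p\rightarrow q),\ \square(p\vee q)\rightarrow\lozenge p\vee\square q\}$. A formula is $\square$-free ($\lozenge$-free) if the symbol $\square$ ($\lozenge$) does not occur in it. -}

module Defs where

open import Data.Nat using (ℕ)
open import Data.Product using (_×_)
open import Data.Empty using (⊥)
open import Level using (Level; suc; _⊔_)

infixr 5 _⇒_
infixr 6 _∨′_
infixr 7 _∧′_
data Fm : Set where
  var  : ℕ → Fm
  _⇒_  : Fm → Fm → Fm
  ⊤′   : Fm
  ⊥′   : Fm
  _∨′_ : Fm → Fm → Fm
  _∧′_ : Fm → Fm → Fm
  □_   : Fm → Fm
  ◇_   : Fm → Fm

¬′_ : Fm → Fm
¬′ A = A ⇒ ⊥′

_⇔_ : Fm → Fm → Fm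
A ⇔ B = (A ⇒ B) ∧′ (B ⇒ A)

Subst : Set
Subst = ℕ → Fm

sub : Subst → Fm → Fm
sub σ (var n)  = σ n
sub σ (A ⇒ B)  = sub σ A ⇒ sub σ B
sub σ ⊤′       = ⊤′
sub σ ⊥′       = ⊥′
sub σ (A ∨′ B) = sub σ A ∨′ sub σ B
sub σ (A ∧′ B) = sub σ A ∧′ sub σ B
sub σ (□ A)    = □ sub σ A
sub σ (◇ A)    = ◇ sub σ A

data □Free : Fm → Set where
  var : ∀ n → □Free (var n)
  imp : ∀ {A B} → □Free A → □Free B → □Free (A ⇒ B)
  top : □Free ⊤′
  bot : □Free ⊥′
  or  : ∀ {A B} → □Free A → □Free B → □Free (A ∨′ B)
  and : ∀ {A B} → □Free A → □Free B → □Free (A ∧′ B)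
  dia : ∀ {A} → □Free A → □Free (◇ A)

data ◇Free : Fm → Set where
  var : ∀ n → ◇Free (var n)
  imp : ∀ {A B} → ◇Free A → ◇Free B → ◇Free (A ⇒ B)
  top : ◇Free ⊤′
  bot : ◇Free ⊥′
  or  : ∀ {A B} → ◇Free A → ◇Free B → ◇Free (A ∨′ B)
  and : ∀ {A B} → ◇Free A → ◇Free B → ◇Free (A ∧′ B)
  box : ∀ {A} → ◇Free A → ◇Free (□ A)

data IPCAx : Fm → Set where
  k    : ∀ A B → IPCAx (A ⇒ B ⇒ A)
  s    : ∀ A B C → IPCAx ((A ⇒ B ⇒ C) ⇒ (A ⇒ B) ⇒ A ⇒ C)
  ∧i   : ∀ A B → IPCAx (A ⇒ B ⇒ A ∧′ B)
  ∧e1  : ∀ A B → IPCAx (A ∧′ B ⇒ A)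
  ∧e2  : ∀ A B → IPCAx (A ∧′ B ⇒ B)
  ∨i1  : ∀ A B → IPCAx (A ⇒ A ∨′ B)
  ∨i2  : ∀ A B → IPCAx (B ⇒ A ∨′ B)
  ∨e   : ∀ A B C → IPCAx ((A ⇒ C) ⇒ (B ⇒ C) ⇒ A ∨′ B ⇒ C)
  ⊥e   : ∀ A → IPCAx (⊥′ ⇒ A)
  ⊤i   : IPCAx ⊤′

p q r : Fm
p = var 0
q = var 1
r = var 2

A1 A2 A3 A4 : Fm
A1 = □ (p ⇒ q) ⇒ (□ p ⇒ □ q)
A2 = □ (p ∨′ q) ⇒ ((◇ p ⇒ □ q) ⇒ □ q)
A3 = ◇ (p ∨′ q) ⇒ ◇ p ∨′ ◇ q
A4 = ¬′ (◇ ⊥′)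

record IsIML {ℓ : Level} (L : Fm → Set ℓ) : Set ℓ where
  field
    subst-closed : ∀ σ A → L A → L (sub σ A)
    ipc          : ∀ A → IPCAx A → L A
    mp           : ∀ A B → L (A ⇒ B) → L A → L B
    ax1          : L A1
    ax2          : L A2
    ax3          : L A3
    ax4          : L A4
    r1           : ∀ A → L A → L (□ A)
    r2           : ∀ A B → L (A ⇒ B) → L (◇ A ⇒ ◇ B)
    r3           : ∀ A B C → L (◇ A ⇒ B ∨′ □ (A ⇒ C)) → L (◇ A ⇒ B ∨′ ◇ C)

data Fbdc : Fm → Set where
  fb1 : Fbdc (◇ (p ⇒ q) ⇒ (□ p ⇒ ◇ q))
  fb2 : Fbdc ((◇ p ⇒ □ q) ⇒ □ (p ⇒ q))
  fb3 : Fbdc (□ (p ∨′ q) ⇒ ◇ p ∨′ □ q)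

-- L_fbdc = L_min ⊕ Fbdc : the least intuitionistic modal logic containing Fbdc,
-- presented inductively as the set of derivable formulas
data Lfbdc : Fm → Set where
  extra : ∀ A → Fbdc A → Lfbdc A
  subst-closed : ∀ σ A → Lfbdc A → Lfbdc (sub σ A)
  ipc   : ∀ A → IPCAx A → Lfbdc A
  mp    : ∀ A B → Lfbdc (A ⇒ B) → Lfbdc A → Lfbdc B
  ax1   : Lfbdc A1
  ax2   : Lfbdc A2
  ax3   : Lfbdc A3
  ax4   : Lfbdc A4
  r1    : ∀ A → Lfbdc A → Lfbdc (□ A)
  r2    : ∀ A B → Lfbdc (A ⇒ B) → Lfbdc (◇ A ⇒ ◇ B)
  r3    : ∀ A B C → Lfbdc (◇ A ⇒ B ∨′ □ (A ⇒ C)) → Lfbdc (◇ A ⇒ B ∨′ ◇ C)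

Independent : {ℓ : Level} → (Fm → Set ℓ) → Set ℓ
Independent L =
  (∀ A → □Free A → L ((□ p) ⇔ A) → ⊥) × (∀ A → ◇Free A → L ((◇ p) ⇔ A) → ⊥)

-- Interpret formulas in the three-element Heyting chain 0 < ½ < 1 equipped with
-- unary operators for □ and ◇. Three such algebras validate L_fbdc: ⟨id, id⟩,
-- ⟨Δ, id⟩ where Δ sends ½ to 0, and ⟨id, ∇⟩ where ∇ sends ½ to 1. The first two
-- have the same ◇, hence agree on every □-free formula, yet disagree on □p when
-- p = ½; so no □-free A satisfies □p ↔ A in a sublogic of L_fbdc. The first and
-- the third do the same for ◇.
module Submission where

open import Defs
open import Level using (Level)
open import Data.Nat using (ℕ)
open import Data.Product using (_,_)
open import Function using (id)
open import Relation.Nullary using (Dec; ¬_; yes; no)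
open import Relation.Nullary.Decidable using (True; toWitness; map′; _×-dec_; _→-dec_)
open import Relation.Binary.PropositionalEquality
  using (_≡_; _≢_; refl; sym; trans; cong; cong₂; module ≡-Reasoning)

data 𝟛 : Set where
  0₃ ½ 1₃ : 𝟛

infixr 5 _⇨_
infixr 6 _⊔_
infixr 7 _⊓_

_⊓_ _⊔_ _⇨_ : 𝟛 → 𝟛 → 𝟛
0₃ ⊓ _  = 0₃
½  ⊓ 0₃ = 0₃
½  ⊓ _  = ½
1₃ ⊓ b  = b

0₃ ⊔ b  = b
½  ⊔ 1₃ = 1₃
½  ⊔ _  = ½
1₃ ⊔ _  = 1₃

0₃ ⇨ _  = 1₃
½  ⇨ 0₃ = 0₃
½  ⇨ _  = 1₃
1₃ ⇨ b  = b

Δ ∇ : 𝟛 → 𝟛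
Δ 1₃ = 1₃
Δ _  = 0₃

∇ 0₃ = 0₃
∇ _  = 1₃

_≟1₃ : (a : 𝟛) → Dec (a ≡ 1₃)
0₃ ≟1₃ = no λ ()
½  ≟1₃ = no λ ()
1₃ ≟1₃ = yes refl

∀₃? : {P : 𝟛 → Set} → (∀ a → Dec (P a)) → Dec (∀ a → P a)
∀₃? P? = map′ (λ (p₀ , p½ , p₁) → λ { 0₃ → p₀ ; ½ → p½ ; 1₃ → p₁ })
              (λ h → h 0₃ , h ½ , h 1₃)
              (P? 0₃ ×-dec P? ½ ×-dec P? 1₃)

-- Truth-table checks: f and g are found by unifying with the goal, after which
-- the certificate argument computes to ⊤ and is filled in automatically.

tautology₂ : {f : 𝟛 → 𝟛 → 𝟛} {_ : True (∀₃? λ a → ∀₃? λ b → f a b ≟1₃)} →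
             ∀ a b → f a b ≡ 1₃
tautology₂ {_} {t} = toWitness t

tautology₃ : {f : 𝟛 → 𝟛 → 𝟛 → 𝟛}
             {_ : True (∀₃? λ a → ∀₃? λ b → ∀₃? λ c → f a b c ≟1₃)} →
             ∀ a b c → f a b c ≡ 1₃
tautology₃ {_} {t} = toWitness t

entailment₂ : {f g : 𝟛 → 𝟛 → 𝟛}
              {_ : True (∀₃? λ a → ∀₃? λ b → f a b ≟1₃ →-dec g a b ≟1₃)} →
              ∀ a b → f a b ≡ 1₃ → g a b ≡ 1₃
entailment₂ {_} {_} {t} = toWitness t

entailment₃ : {f g : 𝟛 → 𝟛 → 𝟛 → 𝟛}
              {_ : True (∀₃? λ a → ∀₃? λ b → ∀₃? λ c → f a b c ≟1₃ →-dec g a b c ≟1₃)} →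
              ∀ a b c → f a b c ≡ 1₃ → g a b c ≡ 1₃
entailment₃ {_} {_} {t} = toWitness t

⇨-K : ∀ a b → a ⇨ b ⇨ a ≡ 1₃
⇨-K = tautology₂

⇨-S : ∀ a b c → (a ⇨ b ⇨ c) ⇨ (a ⇨ b) ⇨ a ⇨ c ≡ 1₃
⇨-S = tautology₃

⊓-intro : ∀ a b → a ⇨ b ⇨ a ⊓ b ≡ 1₃
⊓-intro = tautology₂

⊓-elimˡ : ∀ a b → a ⊓ b ⇨ a ≡ 1₃
⊓-elimˡ = tautology₂

⊓-elimʳ : ∀ a b → a ⊓ b ⇨ b ≡ 1₃
⊓-elimʳ = tautology₂

⊔-introˡ : ∀ a b → a ⇨ a ⊔ b ≡ 1₃
⊔-introˡ = tautology₂

⊔-introʳ : ∀ a b → b ⇨ a ⊔ b ≡ 1₃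
⊔-introʳ = tautology₂

⊔-elim : ∀ a b c → (a ⇨ c) ⇨ (b ⇨ c) ⇨ a ⊔ b ⇨ c ≡ 1₃
⊔-elim = tautology₃

⇨-mp : ∀ {a b} → a ⇨ b ≡ 1₃ → a ≡ 1₃ → b ≡ 1₃
⇨-mp a⇨b refl = a⇨b

⇨-antisym : ∀ a b → (a ⇨ b) ⊓ (b ⇨ a) ≡ 1₃ → a ≡ b
⇨-antisym 0₃ 0₃ _  = refl
⇨-antisym ½  ½  _  = refl
⇨-antisym 1₃ 1₃ _  = refl
⇨-antisym 0₃ ½  ()
⇨-antisym 0₃ 1₃ ()
⇨-antisym ½  0₃ ()
⇨-antisym ½  1₃ ()
⇨-antisym 1₃ 0₃ ()
⇨-antisym 1₃ ½  ()

record Modal𝟛 : Set where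
  constructor ⟨_,_⟩
  field
    [□] [◇] : 𝟛 → 𝟛

open Modal𝟛

⟦_⟧ : Fm → Modal𝟛 → (ℕ → 𝟛) → 𝟛
⟦ var n  ⟧ M v = v n
⟦ A ⇒ B  ⟧ M v = ⟦ A ⟧ M v ⇨ ⟦ B ⟧ M v
⟦ ⊤′     ⟧ M v = 1₃
⟦ ⊥′     ⟧ M v = 0₃
⟦ A ∨′ B ⟧ M v = ⟦ A ⟧ M v ⊔ ⟦ B ⟧ M v
⟦ A ∧′ B ⟧ M v = ⟦ A ⟧ M v ⊓ ⟦ B ⟧ M v
⟦ □ A    ⟧ M v = [□] M (⟦ A ⟧ M v)
⟦ ◇ A    ⟧ M v = [◇] M (⟦ A ⟧ M v)

infix 4 _⊨_
_⊨_ : Modal𝟛 → Fm → Set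
M ⊨ A = ∀ v → ⟦ A ⟧ M v ≡ 1₃

⟦⟧-sub : ∀ {M v} σ A → ⟦ sub σ A ⟧ M v ≡ ⟦ A ⟧ M (λ n → ⟦ σ n ⟧ M v)
⟦⟧-sub σ (var n)  = refl
⟦⟧-sub σ (A ⇒ B)  = cong₂ _⇨_ (⟦⟧-sub σ A) (⟦⟧-sub σ B)
⟦⟧-sub σ ⊤′       = refl
⟦⟧-sub σ ⊥′       = refl
⟦⟧-sub σ (A ∨′ B) = cong₂ _⊔_ (⟦⟧-sub σ A) (⟦⟧-sub σ B)
⟦⟧-sub σ (A ∧′ B) = cong₂ _⊓_ (⟦⟧-sub σ A) (⟦⟧-sub σ B)
⟦⟧-sub {M} σ (□ A) = cong ([□] M) (⟦⟧-sub σ A)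
⟦⟧-sub {M} σ (◇ A) = cong ([◇] M) (⟦⟧-sub σ A)

⊨-⇔ : ∀ {M} A B → M ⊨ A ⇔ B → ∀ v → ⟦ A ⟧ M v ≡ ⟦ B ⟧ M v
⊨-⇔ {M} A B ⊨A⇔B v = ⇨-antisym (⟦ A ⟧ M v) (⟦ B ⟧ M v) (⊨A⇔B v)

IPCAx-valid : ∀ {M A} → IPCAx A → M ⊨ A
IPCAx-valid {M} (k A B)     v = ⇨-K (⟦ A ⟧ M v) (⟦ B ⟧ M v)
IPCAx-valid {M} (s A B C)   v = ⇨-S (⟦ A ⟧ M v) (⟦ B ⟧ M v) (⟦ C ⟧ M v)
IPCAx-valid {M} (∧i A B)    v = ⊓-intro (⟦ A ⟧ M v) (⟦ B ⟧ M v)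
IPCAx-valid {M} (∧e1 A B)   v = ⊓-elimˡ (⟦ A ⟧ M v) (⟦ B ⟧ M v)
IPCAx-valid {M} (∧e2 A B)   v = ⊓-elimʳ (⟦ A ⟧ M v) (⟦ B ⟧ M v)
IPCAx-valid {M} (∨i1 A B)   v = ⊔-introˡ (⟦ A ⟧ M v) (⟦ B ⟧ M v)
IPCAx-valid {M} (∨i2 A B)   v = ⊔-introʳ (⟦ A ⟧ M v) (⟦ B ⟧ M v)
IPCAx-valid {M} (∨e A B C)  v = ⊔-elim (⟦ A ⟧ M v) (⟦ B ⟧ M v) (⟦ C ⟧ M v)
IPCAx-valid     (⊥e A)      v = refl
IPCAx-valid     ⊤i          v = refl

record IsFbdcAlgebra (M : Modal𝟛) : Set where
  open Modal𝟛 M renaming ([□] to □′; [◇] to ◇′)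
  field
    A1-valid  : ∀ a b → □′ (a ⇨ b) ⇨ □′ a ⇨ □′ b ≡ 1₃
    A2-valid  : ∀ a b → □′ (a ⊔ b) ⇨ (◇′ a ⇨ □′ b) ⇨ □′ b ≡ 1₃
    A3-valid  : ∀ a b → ◇′ (a ⊔ b) ⇨ ◇′ a ⊔ ◇′ b ≡ 1₃
    A4-valid  : ◇′ 0₃ ⇨ 0₃ ≡ 1₃
    fb1-valid : ∀ a b → ◇′ (a ⇨ b) ⇨ □′ a ⇨ ◇′ b ≡ 1₃
    fb2-valid : ∀ a b → (◇′ a ⇨ □′ b) ⇨ □′ (a ⇨ b) ≡ 1₃
    fb3-valid : ∀ a b → □′ (a ⊔ b) ⇨ ◇′ a ⊔ □′ b ≡ 1₃
    r1-valid  : □′ 1₃ ≡ 1₃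
    r2-valid  : ∀ a b → a ⇨ b ≡ 1₃ → ◇′ a ⇨ ◇′ b ≡ 1₃
    r3-valid  : ∀ a b c → ◇′ a ⇨ b ⊔ □′ (a ⇨ c) ≡ 1₃ → ◇′ a ⇨ b ⊔ ◇′ c ≡ 1₃

module _ {M : Modal𝟛} (fbdc : IsFbdcAlgebra M) where
  open IsFbdcAlgebra fbdc

  Lfbdc-sound : ∀ {A} → Lfbdc A → M ⊨ A
  Lfbdc-sound (extra _ fb1)          v = fb1-valid (v 0) (v 1)
  Lfbdc-sound (extra _ fb2)          v = fb2-valid (v 0) (v 1)
  Lfbdc-sound (extra _ fb3)          v = fb3-valid (v 0) (v 1)
  Lfbdc-sound (subst-closed σ A ⊢A)  v = trans (⟦⟧-sub σ A) (Lfbdc-sound ⊢A _)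
  Lfbdc-sound (ipc _ ax)             v = IPCAx-valid ax v
  Lfbdc-sound (mp _ _ ⊢A⇒B ⊢A)       v = ⇨-mp (Lfbdc-sound ⊢A⇒B v) (Lfbdc-sound ⊢A v)
  Lfbdc-sound ax1                    v = A1-valid (v 0) (v 1)
  Lfbdc-sound ax2                    v = A2-valid (v 0) (v 1)
  Lfbdc-sound ax3                    v = A3-valid (v 0) (v 1)
  Lfbdc-sound ax4                    v = A4-valid
  Lfbdc-sound (r1 _ ⊢A)              v = trans (cong ([□] M) (Lfbdc-sound ⊢A v)) r1-valid
  Lfbdc-sound (r2 A B ⊢A⇒B)          v =
    r2-valid (⟦ A ⟧ M v) (⟦ B ⟧ M v) (Lfbdc-sound ⊢A⇒B v)
  Lfbdc-sound (r3 A B C ⊢premise)    v =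
    r3-valid (⟦ A ⟧ M v) (⟦ B ⟧ M v) (⟦ C ⟧ M v) (Lfbdc-sound ⊢premise v)

fbdc-id-id : IsFbdcAlgebra ⟨ id , id ⟩
fbdc-id-id = record
  { A1-valid = tautology₂ ; A2-valid = tautology₂ ; A3-valid = tautology₂ ; A4-valid = refl
  ; fb1-valid = tautology₂ ; fb2-valid = tautology₂ ; fb3-valid = tautology₂
  ; r1-valid = refl ; r2-valid = entailment₂ ; r3-valid = entailment₃ }

fbdc-Δ-id : IsFbdcAlgebra ⟨ Δ , id ⟩
fbdc-Δ-id = record
  { A1-valid = tautology₂ ; A2-valid = tautology₂ ; A3-valid = tautology₂ ; A4-valid = refl
  ; fb1-valid = tautology₂ ; fb2-valid = tautology₂ ; fb3-valid = tautology₂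
  ; r1-valid = refl ; r2-valid = entailment₂ ; r3-valid = entailment₃ }

fbdc-id-∇ : IsFbdcAlgebra ⟨ id , ∇ ⟩
fbdc-id-∇ = record
  { A1-valid = tautology₂ ; A2-valid = tautology₂ ; A3-valid = tautology₂ ; A4-valid = refl
  ; fb1-valid = tautology₂ ; fb2-valid = tautology₂ ; fb3-valid = tautology₂
  ; r1-valid = refl ; r2-valid = entailment₂ ; r3-valid = entailment₃ }

⟦⟧-□Free : ∀ {M N} → (∀ a → [◇] M a ≡ [◇] N a) →
           ∀ {A} → □Free A → ∀ v → ⟦ A ⟧ M v ≡ ⟦ A ⟧ N v
⟦⟧-□Free ◇≗ (var n)   v = refl
⟦⟧-□Free ◇≗ (imp A B) v = cong₂ _⇨_ (⟦⟧-□Free ◇≗ A v) (⟦⟧-□Free ◇≗ B v)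
⟦⟧-□Free ◇≗ top       v = refl
⟦⟧-□Free ◇≗ bot       v = refl
⟦⟧-□Free ◇≗ (or A B)  v = cong₂ _⊔_ (⟦⟧-□Free ◇≗ A v) (⟦⟧-□Free ◇≗ B v)
⟦⟧-□Free ◇≗ (and A B) v = cong₂ _⊓_ (⟦⟧-□Free ◇≗ A v) (⟦⟧-□Free ◇≗ B v)
⟦⟧-□Free {M} {N} ◇≗ (dia {A} A□free) v =
  trans (cong ([◇] M) (⟦⟧-□Free ◇≗ A□free v)) (◇≗ (⟦ A ⟧ N v))

⟦⟧-◇Free : ∀ {M N} → (∀ a → [□] M a ≡ [□] N a) →
           ∀ {A} → ◇Free A → ∀ v → ⟦ A ⟧ M v ≡ ⟦ A ⟧ N v
⟦⟧-◇Free □≗ (var n)   v = refl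
⟦⟧-◇Free □≗ (imp A B) v = cong₂ _⇨_ (⟦⟧-◇Free □≗ A v) (⟦⟧-◇Free □≗ B v)
⟦⟧-◇Free □≗ top       v = refl
⟦⟧-◇Free □≗ bot       v = refl
⟦⟧-◇Free □≗ (or A B)  v = cong₂ _⊔_ (⟦⟧-◇Free □≗ A v) (⟦⟧-◇Free □≗ B v)
⟦⟧-◇Free □≗ (and A B) v = cong₂ _⊓_ (⟦⟧-◇Free □≗ A v) (⟦⟧-◇Free □≗ B v)
⟦⟧-◇Free {M} {N} □≗ (box {A} A◇free) v =
  trans (cong ([□] M) (⟦⟧-◇Free □≗ A◇free v)) (□≗ (⟦ A ⟧ N v))

module _ {ℓ : Level} {L : Fm → Set ℓ} (M N : Modal𝟛)
         (M⊨L : ∀ A → L A → M ⊨ A) (N⊨L : ∀ A → L A → N ⊨ A) (a : 𝟛) where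
  open ≡-Reasoning

  private
    v : ℕ → 𝟛
    v _ = a

  □-undefinable : (∀ b → [◇] M b ≡ [◇] N b) → [□] M a ≢ [□] N a →
                  ∀ A → □Free A → ¬ L ((□ p) ⇔ A)
  □-undefinable ◇≗ □a≢ A A□free ⊢□p⇔A = □a≢ (begin
    [□] M a    ≡⟨ ⊨-⇔ (□ p) A (M⊨L _ ⊢□p⇔A) v ⟩
    ⟦ A ⟧ M v  ≡⟨ ⟦⟧-□Free ◇≗ A□free v ⟩
    ⟦ A ⟧ N v  ≡⟨ sym (⊨-⇔ (□ p) A (N⊨L _ ⊢□p⇔A) v) ⟩
    [□] N a    ∎)

  ◇-undefinable : (∀ b → [□] M b ≡ [□] N b) → [◇] M a ≢ [◇] N a →
                  ∀ A → ◇Free A → ¬ L ((◇ p) ⇔ A)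
  ◇-undefinable □≗ ◇a≢ A A◇free ⊢◇p⇔A = ◇a≢ (begin
    [◇] M a    ≡⟨ ⊨-⇔ (◇ p) A (M⊨L _ ⊢◇p⇔A) v ⟩
    ⟦ A ⟧ M v  ≡⟨ ⟦⟧-◇Free □≗ A◇free v ⟩
    ⟦ A ⟧ N v  ≡⟨ sym (⊨-⇔ (◇ p) A (N⊨L _ ⊢◇p⇔A) v) ⟩
    [◇] N a    ∎)

mainTheorem19 : {ℓ : Level} (L : Fm → Set ℓ) → IsIML L → (∀ A → L A → Lfbdc A) → Independent L
mainTheorem19 L _ L⊆Lfbdc =
    □-undefinable ⟨ id , id ⟩ ⟨ Δ , id ⟩ (sound fbdc-id-id) (sound fbdc-Δ-id) ½ (λ _ → refl) (λ ())
  , ◇-undefinable ⟨ id , id ⟩ ⟨ id , ∇ ⟩ (sound fbdc-id-id) (sound fbdc-id-∇) ½ (λ _ → refl) (λ ())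
  where
  sound : ∀ {M} → IsFbdcAlgebra M → ∀ A → L A → M ⊨ A
  sound fbdc A LA = Lfbdc-sound fbdc (L⊆Lfbdc A LA)
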